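{- Let $k=\ell r$ and let $f:\mathbb{F}_2^n\to\mathbb{Z}_{2^k}$ have $2^\ell$-adic components $c_0,\ldots,c_{r-1}$. For $\beta\in(\mathbb{Z}_{2^\ell})^{r-1}$ let $g_\beta=c_{r-1}+\sum_{j=0}^{r-2}\beta_jc_j:\mathbb{F}_2^n\to\mathbb{Z}_{2^\ell}$. If each component $c_j:\mathbb{F}_2^n\to\mathbb{Z}_{2^\ell}$ is differentially $\delta$-uniform, then each $g_\beta$ satisfies $\max_{a\ne0,\,b}\Delta_{g_\beta}(a,b)\le\delta\cdot2^{\ell(r-1)}$, and $f$ satisfies $\max_{a\ne0,\,b}\Delta_f(a,b)\le\delta$.
   Context: The $2^\ell$-adic components are the unique $c_j:\mathbb{F}_2^n\to\mathbb{Z}_{2^\ell}$ (digits in $\{0,\ldots,2^\ell-1\}$) with $f=\sum_{j=0}^{r-1}2^{j\ell}c_j$. For $h:\mathbb{F}_2^n\to\mathbb{Z}_{2^j}$, $\Delta_h(a,b)=|\{x: h(x+a)-h(x)=b\text{ in }\mathbb{Z}_{2^j}\}|$ for $a\in\mathbb{F}_2^n$, $b\in\mathbb{Z}_{2^j}$; $h$ is differentially $\delta$-uniform if $\max_{a\ne0,\,b}\Delta_h(a,b)=\delta$. -}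

module Defs where

open import Data.Nat using (ℕ; zero; suc; _+_; _*_; _^_; _≤_; NonZero)
open import Data.Nat.DivMod using (_/_; _%_)
open import Data.Nat using (≢-nonZero)
open import Data.Nat.Properties using (_≟_; m^n≢0)
import Data.Fin
open import Data.Bool using (Bool; true; false; _xor_)
open import Data.Vec using (Vec; []; _∷_; zipWith; replicate)
open import Data.List using (List; []; _∷_; map; concatMap; length; filter)
open import Data.Fin using (Fin; toℕ)
open import Data.Product using (Σ; _×_; _,_)
open import Relation.Binary.PropositionalEquality using (_≡_)
open import Relation.Nullary using (¬_)

F2n : ℕ → Set
F2n n = Vec Bool n

_⊕_ : ∀ {n} → F2n n → F2n n → F2n n
_⊕_ = zipWith _xor_

zeroV : ∀ n → F2n n
zeroV n = replicate n false

allVecs : ∀ n → List (F2n n)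
allVecs zero = [] ∷ []
allVecs (suc n) = concatMap (λ v → (false ∷ v) ∷ (true ∷ v) ∷ []) (allVecs n)

_mod2^_ : ℕ → ℕ → ℕ
x mod2^ j = _%_ x (2 ^ j) {{m^n≢0 2 j}}

_div2^_ : ℕ → ℕ → ℕ
x div2^ j = _/_ x (2 ^ j) {{m^n≢0 2 j}}

-- A function h : F₂ⁿ → ℤ_{2^j} is represented by h : F₂ⁿ → ℕ, read modulo 2^j.
-- Δ_h(a,b) = #{x : h(x+a) − h(x) = b in ℤ_{2^j}}
--          = #{x : h(x⊕a) ≡ h(x) + b (mod 2^j)}
Δ : ∀ {n} (j : ℕ) → (F2n n → ℕ) → F2n n → ℕ → ℕ
Δ {n} j h a b =
  length (filter (λ x → (h (x ⊕ a) mod2^ j) ≟ ((h x + b) mod2^ j)) (allVecs n))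

MaxΔ≤ : ∀ {n} (j : ℕ) → (F2n n → ℕ) → ℕ → Set
MaxΔ≤ {n} j h D = ∀ (a : F2n n) → ¬ (a ≡ zeroV n) → ∀ (b : Fin (2 ^ j)) → Δ j h a (toℕ b) ≤ D

DiffUniform : ∀ {n} (j : ℕ) → (F2n n → ℕ) → ℕ → Set
DiffUniform {n} j h δ =
  MaxΔ≤ j h δ ×
  Σ (F2n n) (λ a → ¬ (a ≡ zeroV n) × Σ (Fin (2 ^ j)) (λ b → Δ j h a (toℕ b) ≡ δ))

component : ∀ {n} (ℓ k : ℕ) → (F2n n → Fin (2 ^ k)) → ℕ → F2n n → ℕ
component ℓ k f j x = (toℕ (f x) div2^ (j * ℓ)) mod2^ ℓ

lin : ∀ {n} (ℓ s : ℕ) → (Fin s → Fin (2 ^ ℓ)) → (ℕ → F2n n → ℕ) → F2n n → ℕ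
lin ℓ zero β c x = 0
lin ℓ (suc s) β c x = toℕ (β Data.Fin.zero) * c 0 x + lin ℓ s (λ i → β (Data.Fin.suc i)) (λ j → c (suc j)) x

-- g_β = c_{r-1} + Σ_{j=0}^{r-2} β_j c_j  (in ℤ_{2^ℓ}), with r = suc s
gβ : ∀ {n} (ℓ k s : ℕ) → (F2n n → Fin (2 ^ k)) → (Fin s → Fin (2 ^ ℓ)) → F2n n → ℕ
gβ ℓ k s f β x = (component ℓ k f s x + lin ℓ s β (component ℓ k f) x) mod2^ ℓ

-- The lowest 2^ℓ-adic digit c₀ of f is f reduced modulo 2^ℓ, and an equation
-- f(x+a) = f(x) + b modulo 2^k implies its reduction modulo 2^ℓ; hence
-- Δ_f(a,b) ≤ Δ_{c₀}(a, b mod 2^ℓ) ≤ δ. For r = 1, g_β is c₀ itself. For r ≥ 2 the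
-- bound is crude: since each x solves exactly one equation c₀(x+a) = c₀(x) + e,
-- Δ_{g_β}(a,b) ≤ 2ⁿ = Σ_e Δ_{c₀}(a,e) ≤ 2^ℓ δ ≤ δ 2^{ℓ(r-1)}.
module Submission where

open import Defs
open import Data.Nat using (ℕ; zero; suc; _+_; _*_; _^_; _∸_; _≤_; _<_; z≤n; NonZero)
open import Data.Nat.Properties
open import Data.Nat.DivMod using (_%_; %-distribˡ-+; m%n%n≡m%n; m%n<n; [m+n]%n≡m%n; m∣n⇒o%n%m≡o%m; n/1≡n)
open import Data.Nat.Divisibility using (_∣_; m∣m*n)
open import Data.Fin using (Fin; zero; toℕ; fromℕ<)
open import Data.Fin.Properties using (toℕ-fromℕ<)
open import Data.Product using (_×_; _,_; ∃-syntax; proj₁)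
open import Data.Sum using (inj₁; inj₂)
open import Data.Bool using (true; false)
open import Data.List using ([]; _∷_; length; filter)
open import Data.List.Properties using (length-filter)
open import Data.List.Relation.Unary.All as All using (All; []; _∷_)
open import Data.List.Relation.Unary.All.Properties using (all-filter) renaming (filter⁺ to All-filter⁺)
open import Data.List.Relation.Binary.Sublist.Propositional using (⊆-refl)
open import Data.List.Relation.Binary.Sublist.Propositional.Properties using (filter⁺; filter-⊆; length-mono-≤)
open import Relation.Binary.PropositionalEquality
open import Relation.Nullary using (¬_; does; contradiction)
open import Relation.Unary using (Pred; Decidable)
open import Relation.Unary.Properties using (∁?)

module _ {a p q} {A : Set a} {P : Pred A p} {Q : Pred A q} (P? : Decidable P) (Q? : Decidable Q) where

  length-filter-mono : (∀ {x} → P x → Q x) → ∀ xs → length (filter P? xs) ≤ length (filter Q? xs)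
  length-filter-mono P⇒Q xs = length-mono-≤ (filter⁺ P? Q? (λ { refl → P⇒Q }) (⊆-refl {x = xs}))

module _ {a p} {A : Set a} {P : Pred A p} (P? : Decidable P) where

  length-filter+length-filter-∁ : ∀ xs → length (filter P? xs) + length (filter (∁? P?) xs) ≡ length xs
  length-filter+length-filter-∁ [] = refl
  length-filter+length-filter-∁ (x ∷ xs) with does (P? x)
  ... | true  = cong suc (length-filter+length-filter-∁ xs)
  ... | false = trans (+-suc _ _) (cong suc (length-filter+length-filter-∁ xs))

module _ {a p} {A : Set a} {P : ℕ → Pred A p} (P? : ∀ e → Decidable (P e)) where

  length-≤-classes : ∀ m d xs → All (λ x → ∃[ e ] e < m × P e x) xs
    → (∀ e → e < m → length (filter (P? e) xs) ≤ d) → length xs ≤ m * d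
  length-≤-classes zero    d []      _                 _       = z≤n
  length-≤-classes zero    d (_ ∷ _) ((_ , () , _) ∷ _) _
  length-≤-classes (suc m) d xs      covered           bounded = begin
    length xs                                   ≡⟨ length-filter+length-filter-∁ (P? m) xs ⟨
    length (filter (P? m) xs) + length rest     ≤⟨ +-mono-≤ (bounded m ≤-refl)
                                                     (length-≤-classes m d rest covered′ bounded′) ⟩
    d + m * d                                   ∎
    where
    open ≤-Reasoning
    rest = filter (∁? (P? m)) xs

    narrow : ∀ {x} → ¬ P m x × (∃[ e ] e < suc m × P e x) → ∃[ e ] e < m × P e x
    narrow (¬Pm , e , e<1+m , Pe) with m<1+n⇒m<n∨m≡n e<1+m
    ... | inj₁ e<m  = e , e<m , Pe
    ... | inj₂ refl = contradiction Pe ¬Pm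

    covered′ : All (λ x → ∃[ e ] e < m × P e x) rest
    covered′ = All.map narrow (All.zip (all-filter (∁? (P? m)) xs , All-filter⁺ (∁? (P? m)) covered))

    bounded′ : ∀ e → e < m → length (filter (P? e) rest) ≤ d
    bounded′ e e<m = ≤-trans
      (length-mono-≤ (filter⁺ (P? e) (P? e) (λ { refl Pe → Pe }) (filter-⊆ (∁? (P? m)) xs)))
      (bounded e (m<n⇒m<1+n e<m))

module _ (M : ℕ) .{{_ : NonZero M}} where

  %-cong-+ : ∀ {x x′ y y′} → x % M ≡ x′ % M → y % M ≡ y′ % M → (x + y) % M ≡ (x′ + y′) % M
  %-cong-+ {x} {x′} {y} {y′} x≡x′ y≡y′ = begin
    (x + y) % M             ≡⟨ %-distribˡ-+ x y M ⟩
    (x % M + y % M) % M     ≡⟨ cong₂ (λ u v → (u + v) % M) x≡x′ y≡y′ ⟩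
    (x′ % M + y′ % M) % M   ≡⟨ %-distribˡ-+ x′ y′ M ⟨
    (x′ + y′) % M           ∎
    where open ≡-Reasoning

  %-difference : ∀ u v → ∃[ e ] e < M × u % M ≡ (v + e) % M
  %-difference u v = e , m%n<n _ M , sym (begin
    (v + e) % M               ≡⟨ %-cong-+ (sym (m%n%n≡m%n v M)) (m%n%n≡m%n (t + u) M) ⟩
    (r + (t + u)) % M         ≡⟨ cong (_% M) (+-assoc r t u) ⟨
    (r + t + u) % M           ≡⟨ cong (λ z → (z + u) % M) (m+[n∸m]≡n (<⇒≤ (m%n<n v M))) ⟩
    (M + u) % M               ≡⟨ cong (_% M) (+-comm M u) ⟩
    (u + M) % M               ≡⟨ [m+n]%n≡m%n u M ⟩
    u % M                     ∎)
    where
    open ≡-Reasoning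
    r = v % M
    t = M ∸ r
    e = (t + u) % M

^-monoʳ-∣ : ∀ m {i j} → i ≤ j → m ^ i ∣ m ^ j
^-monoʳ-∣ m {i} {j} i≤j = subst (m ^ i ∣_) m^i*m^[j∸i]≡m^j (m∣m*n (m ^ (j ∸ i)))
  where
  m^i*m^[j∸i]≡m^j : m ^ i * m ^ (j ∸ i) ≡ m ^ j
  m^i*m^[j∸i]≡m^j = trans (sym (^-distribˡ-+-* m i (j ∸ i))) (cong (m ^_) (m+[n∸m]≡n i≤j))

mod2^-mod2^ : ∀ {i j} → i ≤ j → ∀ x → (x mod2^ j) mod2^ i ≡ x mod2^ i
mod2^-mod2^ {i} {j} i≤j x =
  m∣n⇒o%n%m≡o%m (2 ^ i) (2 ^ j) x {{m^n≢0 2 i}} {{m^n≢0 2 j}} (^-monoʳ-∣ 2 i≤j)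

Δ-mono : ∀ {n} i j (h h′ : F2n n → ℕ) {a b b′}
  → (∀ {x} → h (x ⊕ a) mod2^ i ≡ (h x + b) mod2^ i → h′ (x ⊕ a) mod2^ j ≡ (h′ x + b′) mod2^ j)
  → Δ i h a b ≤ Δ j h′ a b′
Δ-mono {n} i j h h′ imp = length-filter-mono (λ _ → _ ≟ _) (λ _ → _ ≟ _) imp (allVecs n)

MaxΔ≤-weaken : ∀ {n} j (h : F2n n → ℕ) {D D′} → D ≤ D′ → MaxΔ≤ j h D → MaxΔ≤ j h D′
MaxΔ≤-weaken j h D≤D′ bound a a≢0 b = ≤-trans (bound a a≢0 b) D≤D′

MaxΔ≤-fromReduction : ∀ {n} ℓ k (h h′ : F2n n → ℕ) {D} → ℓ ≤ k
  → (∀ x → h x mod2^ ℓ ≡ h′ x mod2^ ℓ) → MaxΔ≤ ℓ h′ D → MaxΔ≤ k h D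
MaxΔ≤-fromReduction ℓ k h h′ ℓ≤k h≡h′ bound a a≢0 b =
  ≤-trans (Δ-mono k ℓ h h′ reduce) (bound a a≢0 b′)
  where
  open ≡-Reasoning
  instance
    2^ℓ-nonZero : NonZero (2 ^ ℓ)
    2^ℓ-nonZero = m^n≢0 2 ℓ
  b′ = fromℕ< (m%n<n (toℕ b) (2 ^ ℓ))
  b≡b′ : toℕ b mod2^ ℓ ≡ toℕ b′ mod2^ ℓ
  b≡b′ = trans (sym (m%n%n≡m%n (toℕ b) (2 ^ ℓ))) (cong (_mod2^ ℓ) (sym (toℕ-fromℕ< _)))
  reduce : ∀ {x} → h (x ⊕ a) mod2^ k ≡ (h x + toℕ b) mod2^ k
         → h′ (x ⊕ a) mod2^ ℓ ≡ (h′ x + toℕ b′) mod2^ ℓ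
  reduce {x} eq = begin
    h′ (x ⊕ a) mod2^ ℓ                 ≡⟨ h≡h′ (x ⊕ a) ⟨
    h (x ⊕ a) mod2^ ℓ                  ≡⟨ mod2^-mod2^ ℓ≤k (h (x ⊕ a)) ⟨
    (h (x ⊕ a) mod2^ k) mod2^ ℓ        ≡⟨ cong (_mod2^ ℓ) eq ⟩
    ((h x + toℕ b) mod2^ k) mod2^ ℓ    ≡⟨ mod2^-mod2^ ℓ≤k (h x + toℕ b) ⟩
    (h x + toℕ b) mod2^ ℓ              ≡⟨ %-cong-+ (2 ^ ℓ) (h≡h′ x) b≡b′ ⟩
    (h′ x + toℕ b′) mod2^ ℓ            ∎

length-allVecs-≤ : ∀ {n δ} ℓ (h : F2n n → ℕ) → MaxΔ≤ ℓ h δ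
  → (a : F2n n) → ¬ a ≡ zeroV n → length (allVecs n) ≤ 2 ^ ℓ * δ
length-allVecs-≤ {n} {δ} ℓ h bound a a≢0 =
  length-≤-classes (λ e x → h (x ⊕ a) mod2^ ℓ ≟ (h x + e) mod2^ ℓ) (2 ^ ℓ) δ (allVecs n)
    (All.universal (λ x → %-difference (2 ^ ℓ) {{m^n≢0 2 ℓ}} (h (x ⊕ a)) (h x)) (allVecs n))
    (λ e e<2^ℓ → subst (λ e → Δ ℓ h a e ≤ δ) (toℕ-fromℕ< e<2^ℓ) (bound a a≢0 (fromℕ< e<2^ℓ)))

MaxΔ≤-anyFunction : ∀ {n δ} ℓ (h : F2n n → ℕ) → MaxΔ≤ ℓ h δ
  → ∀ j (g : F2n n → ℕ) → MaxΔ≤ j g (2 ^ ℓ * δ)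
MaxΔ≤-anyFunction {n} ℓ h bound j g a a≢0 b =
  ≤-trans (length-filter (λ _ → _ ≟ _) (allVecs n)) (length-allVecs-≤ ℓ h bound a a≢0)

component-zero≡mod2^ : ∀ {n} ℓ k (f : F2n n → Fin (2 ^ k)) x
  → component ℓ k f 0 x ≡ toℕ (f x) mod2^ ℓ
component-zero≡mod2^ ℓ k f x = cong (_mod2^ ℓ) (n/1≡n (toℕ (f x)))

MaxΔ≤-gβ : ∀ {n} ℓ k s {δ} (f : F2n n → Fin (2 ^ k)) → MaxΔ≤ ℓ (component ℓ k f 0) δ
  → ∀ β → MaxΔ≤ ℓ (gβ ℓ k s f β) (δ * 2 ^ (ℓ * s))
MaxΔ≤-gβ ℓ k zero {δ} f c₀-bound β =
  MaxΔ≤-weaken ℓ g δ≤δ*2^[ℓ*0]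
    (MaxΔ≤-fromReduction ℓ ℓ g (component ℓ k f 0) ≤-refl g≡c₀ c₀-bound)
  where
  g = gβ ℓ k zero f β
  δ≤δ*2^[ℓ*0] : δ ≤ δ * 2 ^ (ℓ * 0)
  δ≤δ*2^[ℓ*0] =
    ≤-reflexive (trans (sym (*-identityʳ δ)) (cong (λ z → δ * 2 ^ z) (sym (*-zeroʳ ℓ))))
  g≡c₀ : ∀ x → g x mod2^ ℓ ≡ component ℓ k f 0 x mod2^ ℓ
  g≡c₀ x = trans (m%n%n≡m%n _ (2 ^ ℓ) {{m^n≢0 2 ℓ}}) (cong (_mod2^ ℓ) (+-identityʳ _))
MaxΔ≤-gβ ℓ k (suc s) {δ} f c₀-bound β =
  MaxΔ≤-weaken ℓ g 2^ℓ*δ≤δ*2^[ℓ*[1+s]]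
    (MaxΔ≤-anyFunction ℓ (component ℓ k f 0) c₀-bound ℓ g)
  where
  g = gβ ℓ k (suc s) f β
  2^ℓ*δ≤δ*2^[ℓ*[1+s]] : 2 ^ ℓ * δ ≤ δ * 2 ^ (ℓ * suc s)
  2^ℓ*δ≤δ*2^[ℓ*[1+s]] = subst (_≤ δ * 2 ^ (ℓ * suc s)) (*-comm δ (2 ^ ℓ))
    (*-monoʳ-≤ δ (^-monoʳ-≤ 2 (m≤m*n ℓ (suc s))))

corollary5p9 : (n ℓ s δ : ℕ) (f : F2n n → Fin (2 ^ (ℓ * suc s)))
    → (∀ (j : Fin (suc s)) → DiffUniform ℓ (component ℓ (ℓ * suc s) f (toℕ j)) δ)
    → (∀ (β : Fin s → Fin (2 ^ ℓ)) → MaxΔ≤ ℓ (gβ ℓ (ℓ * suc s) s f β) (δ * 2 ^ (ℓ * s)))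
      × MaxΔ≤ (ℓ * suc s) (λ x → toℕ (f x)) δ
corollary5p9 n ℓ s δ f uniform =
  MaxΔ≤-gβ ℓ k s f c₀-bound ,
  MaxΔ≤-fromReduction ℓ k (λ x → toℕ (f x)) (component ℓ k f 0) (m≤m*n ℓ (suc s)) f≡c₀ c₀-bound
  where
  k = ℓ * suc s
  c₀-bound : MaxΔ≤ ℓ (component ℓ k f 0) δ
  c₀-bound = proj₁ (uniform zero)
  f≡c₀ : ∀ x → toℕ (f x) mod2^ ℓ ≡ component ℓ k f 0 x mod2^ ℓ
  f≡c₀ x = sym (trans (cong (_mod2^ ℓ) (component-zero≡mod2^ ℓ k f x))
                      (m%n%n≡m%n _ (2 ^ ℓ) {{m^n≢0 2 ℓ}}))
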